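{- Let $P\colon\mathcal C\to\mathcal A$, $S\colon\mathcal A\to\mathcal C$ be a dual adjunction, $T\colon\mathcal C\to\mathcal C$ an endofunctor, $(L,\rho)$ a logic for $T$-coalgebras, and $(X_1,\gamma_1)$, $(X_2,\gamma_2)$ two $T$-coalgebras. A jointly mono span $X_1\xleftarrow{\pi_1}B\xrightarrow{\pi_2}X_2$ is a $\rho$-bisimulation between $(X_1,\gamma_1)$ and $(X_2,\gamma_2)$ if and only if its dual span $(\bar B,\bar\pi_1,\bar\pi_2)$ is a congruence between the complex algebras $\gamma_1^*$ and $\gamma_2^*$.
   Context: A dual adjunction between categories $\mathcal C$ and $\mathcal A$ consists of contravariant functors $P\colon\mathcal C\to\mathcal A$, $S\colon\mathcal A\to\mathcal C$ with a bijection $\mathcal C(X,SA)\cong\mathcal A(A,PX)$ natural in $X,A$. A $T$-coalgebra is a pair $(X,\gamma)$ with $\gamma\colon X\to TX$ in $\mathcal C$. A logic for $T$-coalgebras is a pair $(L,\rho)$ with $L\colon\mathcal A\to\mathcal A$ an endofunctor and $\rho\colon LP\to PT$ a natural transformation. The complex algebra of $(X,\gamma)$ is $\gamma^*=P\gamma\circ\rho_X\colon LPX\to PX$. A span $X_1\xleftarrow{\pi_1}B\xrightarrow{\pi_2}X_2$ is jointly mono if for all morphisms $h,h'$ into $B$, $\pi_1h=\pi_1h'$ and $\pi_2h=\pi_2h'$ imply $h=h'$. Standing assumptions: $\mathcal C$ has pullbacks, and $\mathcal A$ has pullbacks or $\mathcal C$ has pushouts. The dual span $(\bar B,\bar\pi_1,\bar\pi_2)$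 of $(B,\pi_1,\pi_2)$ is the pullback in $\mathcal A$ of the cospan $PX_1\xrightarrow{P\pi_1}PB\xleftarrow{P\pi_2}PX_2$, with $\bar\pi_i\colon\bar B\to PX_i$. The span $(B,\pi_1,\pi_2)$ is a $\rho$-bisimulation between $(X_1,\gamma_1)$ and $(X_2,\gamma_2)$ if $P\pi_1\circ\gamma_1^*\circ L\bar\pi_1=P\pi_2\circ\gamma_2^*\circ L\bar\pi_2$. A jointly mono span $(Q,q_1,q_2)$ in $\mathcal A$ with $q_i\colon Q\to PX_i$ is a congruence between $\gamma_1^*$ and $\gamma_2^*$ if there is a morphism $\beta\colon LQ\to Q$ with $q_i\circ\beta=\gamma_i^*\circ Lq_i$ for $i=1,2$. -}

module Defs where

open import Level using (Level; _⊔_) renaming (suc to lsuc)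
open import Data.Product using (Σ; Σ-syntax; _×_; _,_)
open import Relation.Binary using (Rel; IsEquivalence)

record Category (o ℓ e : Level) : Set (lsuc (o ⊔ ℓ ⊔ e)) where
  infixr 9 _∘_
  infix 4 _≈_
  field
    Obj   : Set o
    _⇒_   : Obj → Obj → Set ℓ
    _≈_   : ∀ {A B} → Rel (A ⇒ B) e
    id    : ∀ {A} → A ⇒ A
    _∘_   : ∀ {A B C} → B ⇒ C → A ⇒ B → A ⇒ C
    equiv : ∀ {A B} → IsEquivalence (_≈_ {A} {B})
    ∘-resp-≈  : ∀ {A B C} {f g : B ⇒ C} {h i : A ⇒ B} →
                f ≈ g → h ≈ i → f ∘ h ≈ g ∘ i
    identityˡ : ∀ {A B} {f : A ⇒ B} → id ∘ f ≈ f
    identityʳ : ∀ {A B} {f : A ⇒ B} → f ∘ id ≈ f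
    assoc     : ∀ {A B C D} {f : A ⇒ B} {g : B ⇒ C} {h : C ⇒ D} →
                (h ∘ g) ∘ f ≈ h ∘ (g ∘ f)

open Category public using (Obj)

module _ {o ℓ e} (C : Category o ℓ e) where
  open Category C hiding (Obj)
  private
    Ob = Obj C
  infix 4 _[_,_] _[_≈_]
  infixr 9 _[_∘_]
  _[_,_] : Ob → Ob → Set ℓ
  _[_,_] = _⇒_
  _[_≈_] : ∀ {A B} → A ⇒ B → A ⇒ B → Set e
  _[_≈_] = _≈_
  _[_∘_] : ∀ {A B D} → B ⇒ D → A ⇒ B → A ⇒ D
  _[_∘_] = _∘_

record Functor {o ℓ e o' ℓ' e'} (C : Category o ℓ e) (D : Category o' ℓ' e')
       : Set (o ⊔ ℓ ⊔ e ⊔ o' ⊔ ℓ' ⊔ e') where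
  field
    F₀ : Obj C → Obj D
    F₁ : ∀ {A B} → C [ A , B ] → D [ F₀ A , F₀ B ]
    identity     : ∀ {A} → D [ F₁ (Category.id C {A}) ≈ Category.id D ]
    homomorphism : ∀ {A B E} {f : C [ A , B ]} {g : C [ B , E ]} →
                   D [ F₁ (C [ g ∘ f ]) ≈ D [ F₁ g ∘ F₁ f ] ]
    F-resp-≈     : ∀ {A B} {f g : C [ A , B ]} → C [ f ≈ g ] → D [ F₁ f ≈ F₁ g ]

record ContraFunctor {o ℓ e o' ℓ' e'} (C : Category o ℓ e) (D : Category o' ℓ' e')
       : Set (o ⊔ ℓ ⊔ e ⊔ o' ⊔ ℓ' ⊔ e') where
  field
    F₀ : Obj C → Obj D
    F₁ : ∀ {A B} → C [ A , B ] → D [ F₀ B , F₀ A ]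
    identity     : ∀ {A} → D [ F₁ (Category.id C {A}) ≈ Category.id D ]
    homomorphism : ∀ {A B E} {f : C [ A , B ]} {g : C [ B , E ]} →
                   D [ F₁ (C [ g ∘ f ]) ≈ D [ F₁ f ∘ F₁ g ] ]
    F-resp-≈     : ∀ {A B} {f g : C [ A , B ]} → C [ f ≈ g ] → D [ F₁ f ≈ F₁ g ]

record DualAdjunction {o ℓ e o' ℓ' e'} (C : Category o ℓ e) (A : Category o' ℓ' e')
       (P : ContraFunctor C A) (S : ContraFunctor A C)
       : Set (o ⊔ ℓ ⊔ e ⊔ o' ⊔ ℓ' ⊔ e') where
  module P = ContraFunctor P
  module S = ContraFunctor S
  field
    φ : ∀ {X : Obj C} {Y : Obj A} → C [ X , S.F₀ Y ] → A [ Y , P.F₀ X ]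
    ψ : ∀ {X : Obj C} {Y : Obj A} → A [ Y , P.F₀ X ] → C [ X , S.F₀ Y ]
    φ-resp-≈ : ∀ {X Y} {h h' : C [ X , S.F₀ Y ]} → C [ h ≈ h' ] → A [ φ h ≈ φ h' ]
    ψ-resp-≈ : ∀ {X Y} {k k' : A [ Y , P.F₀ X ]} → A [ k ≈ k' ] → C [ ψ k ≈ ψ k' ]
    ψφ : ∀ {X Y} (h : C [ X , S.F₀ Y ]) → C [ ψ (φ h) ≈ h ]
    φψ : ∀ {X Y} (k : A [ Y , P.F₀ X ]) → A [ φ (ψ k) ≈ k ]
    natural : ∀ {X X' : Obj C} {Y Y' : Obj A}
              (f : C [ X' , X ]) (g : A [ Y' , Y ]) (h : C [ X , S.F₀ Y ]) →
              A [ φ (C [ S.F₁ g ∘ C [ h ∘ f ] ]) ≈ A [ P.F₁ f ∘ A [ φ h ∘ g ] ] ]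

module _ {o ℓ e} (C : Category o ℓ e) where
  open Category C hiding (Obj)
  private
    Ob = Obj C

  record IsPullback {X₁ X₂ Z Pb : Ob} (f : X₁ ⇒ Z) (g : X₂ ⇒ Z)
                    (p₁ : Pb ⇒ X₁) (p₂ : Pb ⇒ X₂) : Set (o ⊔ ℓ ⊔ e) where
    field
      commute   : f ∘ p₁ ≈ g ∘ p₂
      universal : ∀ {Q} (h₁ : Q ⇒ X₁) (h₂ : Q ⇒ X₂) → f ∘ h₁ ≈ g ∘ h₂ → Q ⇒ Pb
      p₁∘universal : ∀ {Q} {h₁ : Q ⇒ X₁} {h₂ : Q ⇒ X₂} (eq : f ∘ h₁ ≈ g ∘ h₂) →
                     p₁ ∘ universal h₁ h₂ eq ≈ h₁
      p₂∘universal : ∀ {Q} {h₁ : Q ⇒ X₁} {h₂ : Q ⇒ X₂} (eq : f ∘ h₁ ≈ g ∘ h₂) →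
                     p₂ ∘ universal h₁ h₂ eq ≈ h₂
      unique : ∀ {Q} {h₁ : Q ⇒ X₁} {h₂ : Q ⇒ X₂} (eq : f ∘ h₁ ≈ g ∘ h₂) (u : Q ⇒ Pb) →
               p₁ ∘ u ≈ h₁ → p₂ ∘ u ≈ h₂ → u ≈ universal h₁ h₂ eq

  record IsPushout {X₁ X₂ Z Po : Ob} (f : Z ⇒ X₁) (g : Z ⇒ X₂)
                   (i₁ : X₁ ⇒ Po) (i₂ : X₂ ⇒ Po) : Set (o ⊔ ℓ ⊔ e) where
    field
      commute   : i₁ ∘ f ≈ i₂ ∘ g
      universal : ∀ {Q} (h₁ : X₁ ⇒ Q) (h₂ : X₂ ⇒ Q) → h₁ ∘ f ≈ h₂ ∘ g → Po ⇒ Q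
      universal∘i₁ : ∀ {Q} {h₁ : X₁ ⇒ Q} {h₂ : X₂ ⇒ Q} (eq : h₁ ∘ f ≈ h₂ ∘ g) →
                     universal h₁ h₂ eq ∘ i₁ ≈ h₁
      universal∘i₂ : ∀ {Q} {h₁ : X₁ ⇒ Q} {h₂ : X₂ ⇒ Q} (eq : h₁ ∘ f ≈ h₂ ∘ g) →
                     universal h₁ h₂ eq ∘ i₂ ≈ h₂
      unique : ∀ {Q} {h₁ : X₁ ⇒ Q} {h₂ : X₂ ⇒ Q} (eq : h₁ ∘ f ≈ h₂ ∘ g) (u : Po ⇒ Q) →
               u ∘ i₁ ≈ h₁ → u ∘ i₂ ≈ h₂ → u ≈ universal h₁ h₂ eq

  HasPullbacks : Set (o ⊔ ℓ ⊔ e)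
  HasPullbacks = ∀ {X₁ X₂ Z} (f : X₁ ⇒ Z) (g : X₂ ⇒ Z) →
                 Σ[ Pb ∈ Ob ] Σ[ p₁ ∈ Pb ⇒ X₁ ] Σ[ p₂ ∈ Pb ⇒ X₂ ] IsPullback f g p₁ p₂

  HasPushouts : Set (o ⊔ ℓ ⊔ e)
  HasPushouts = ∀ {X₁ X₂ Z} (f : Z ⇒ X₁) (g : Z ⇒ X₂) →
                Σ[ Po ∈ Ob ] Σ[ i₁ ∈ X₁ ⇒ Po ] Σ[ i₂ ∈ X₂ ⇒ Po ] IsPushout f g i₁ i₂

  JointlyMono : ∀ {X₁ X₂ B : Ob} → B ⇒ X₁ → B ⇒ X₂ → Set (o ⊔ ℓ ⊔ e)
  JointlyMono {B = B} π₁ π₂ = ∀ {Z} (h h' : Z ⇒ B) →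
    π₁ ∘ h ≈ π₁ ∘ h' → π₂ ∘ h ≈ π₂ ∘ h' → h ≈ h'

module _ {o ℓ e} {C : Category o ℓ e} where

  record Coalgebra (T : Functor C C) : Set (o ⊔ ℓ) where
    constructor coalg
    field
      carrier   : Obj C
      structure : C [ carrier , Functor.F₀ T carrier ]

module _ {o ℓ e o' ℓ' e'} {C : Category o ℓ e} {A : Category o' ℓ' e'} where

  record Logic (P : ContraFunctor C A) (T : Functor C C)
         : Set (o ⊔ ℓ ⊔ e ⊔ o' ⊔ ℓ' ⊔ e') where
    module P = ContraFunctor P
    module T = Functor T
    field
      L : Functor A A
    module L = Functor L
    field
      ρ : ∀ (X : Obj C) → A [ L.F₀ (P.F₀ X) , P.F₀ (T.F₀ X) ]
      ρ-natural : ∀ {X Y : Obj C} (f : C [ X , Y ]) →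
                  A [ A [ ρ X ∘ L.F₁ (P.F₁ f) ] ≈ A [ P.F₁ (T.F₁ f) ∘ ρ Y ] ]

  module _ {P : ContraFunctor C A} {T : Functor C C} (lg : Logic P T) where
    open Logic lg

    complexAlgebra : (c : Coalgebra T) →
      A [ L.F₀ (P.F₀ (Coalgebra.carrier c)) , P.F₀ (Coalgebra.carrier c) ]
    complexAlgebra (coalg X γ) = A [ P.F₁ γ ∘ ρ X ]

    IsDualSpan : ∀ {X₁ X₂ B : Obj C} (π₁ : C [ B , X₁ ]) (π₂ : C [ B , X₂ ])
                 {B̄ : Obj A} (π̄₁ : A [ B̄ , P.F₀ X₁ ]) (π̄₂ : A [ B̄ , P.F₀ X₂ ]) →
                 Set (o' ⊔ ℓ' ⊔ e')
    IsDualSpan π₁ π₂ π̄₁ π̄₂ = IsPullback A (P.F₁ π₁) (P.F₁ π₂) π̄₁ π̄₂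

    IsRhoBisimulation : (c₁ c₂ : Coalgebra T) {B : Obj C}
      (π₁ : C [ B , Coalgebra.carrier c₁ ]) (π₂ : C [ B , Coalgebra.carrier c₂ ])
      {B̄ : Obj A} (π̄₁ : A [ B̄ , P.F₀ (Coalgebra.carrier c₁) ])
      (π̄₂ : A [ B̄ , P.F₀ (Coalgebra.carrier c₂) ]) → Set e'
    IsRhoBisimulation c₁ c₂ π₁ π₂ π̄₁ π̄₂ =
      A [ A [ P.F₁ π₁ ∘ A [ complexAlgebra c₁ ∘ L.F₁ π̄₁ ] ]
        ≈ A [ P.F₁ π₂ ∘ A [ complexAlgebra c₂ ∘ L.F₁ π̄₂ ] ] ]

    IsCongruence : (c₁ c₂ : Coalgebra T) {Q : Obj A}
      (q₁ : A [ Q , P.F₀ (Coalgebra.carrier c₁) ])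
      (q₂ : A [ Q , P.F₀ (Coalgebra.carrier c₂) ]) → Set (o' ⊔ ℓ' ⊔ e')
    IsCongruence c₁ c₂ {Q} q₁ q₂ =
      JointlyMono A q₁ q₂ ×
      Σ[ β ∈ A [ L.F₀ Q , Q ] ]
        (A [ A [ q₁ ∘ β ] ≈ A [ complexAlgebra c₁ ∘ L.F₁ q₁ ] ] ×
         A [ A [ q₂ ∘ β ] ≈ A [ complexAlgebra c₂ ∘ L.F₁ q₂ ] ])

-- The ρ-bisimulation equation says precisely that (γ₁* ∘ Lπ̄₁, γ₂* ∘ Lπ̄₂) is a cone
-- over the cospan Pπ₁, Pπ₂ with apex LB̄; since B̄ is its pullback, such cones are
-- exactly the maps β : LB̄ → B̄ making B̄ a congruence, and the pullback legs are
-- automatically jointly mono.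
module Submission where

open import Defs
open import Data.Product using (_×_; _,_)
open import Data.Sum using (_⊎_)
open import Relation.Binary using (IsEquivalence)

module _ {o ℓ e} (C : Category o ℓ e) where
  open Category C hiding (Obj)
  open module ≈ {X Y} = IsEquivalence (equiv {X} {Y}) using (refl; sym; trans)

  commute-∘ʳ : ∀ {X₁ X₂ Z W V} {f : X₁ ⇒ Z} {g : X₂ ⇒ Z} {p₁ : W ⇒ X₁} {p₂ : W ⇒ X₂}
               (k : V ⇒ W) → f ∘ p₁ ≈ g ∘ p₂ → f ∘ (p₁ ∘ k) ≈ g ∘ (p₂ ∘ k)
  commute-∘ʳ k sq = trans (sym assoc) (trans (∘-resp-≈ sq refl) assoc)

  commute-via-factorisation :
    ∀ {X₁ X₂ Z W V} {f : X₁ ⇒ Z} {g : X₂ ⇒ Z} {p₁ : W ⇒ X₁} {p₂ : W ⇒ X₂}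
      {a : V ⇒ X₁} {b : V ⇒ X₂} (k : V ⇒ W) →
    f ∘ p₁ ≈ g ∘ p₂ → p₁ ∘ k ≈ a → p₂ ∘ k ≈ b → f ∘ a ≈ g ∘ b
  commute-via-factorisation k sq p₁k≈a p₂k≈b =
    trans (∘-resp-≈ refl (sym p₁k≈a))
      (trans (commute-∘ʳ k sq) (∘-resp-≈ refl p₂k≈b))

  pullback-jointlyMono : ∀ {X₁ X₂ Z Pb} {f : X₁ ⇒ Z} {g : X₂ ⇒ Z}
                         {p₁ : Pb ⇒ X₁} {p₂ : Pb ⇒ X₂} →
                         IsPullback C f g p₁ p₂ → JointlyMono C p₁ p₂
  pullback-jointlyMono {f = f} {g} {p₁} {p₂} pb h h' p₁h≈p₁h' p₂h≈p₂h' =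
    trans (unique sq h refl refl) (sym (unique sq h' (sym p₁h≈p₁h') (sym p₂h≈p₂h')))
    where
    open IsPullback pb
    sq : f ∘ (p₁ ∘ h) ≈ g ∘ (p₂ ∘ h)
    sq = commute-∘ʳ h commute

module _ {o ℓ e o' ℓ' e'} {C : Category o ℓ e} {A : Category o' ℓ' e'}
         {P : ContraFunctor C A} {T : Functor C C} (lg : Logic P T)
         (c₁ c₂ : Coalgebra T) {B : Obj C}
         {π₁ : C [ B , Coalgebra.carrier c₁ ]} {π₂ : C [ B , Coalgebra.carrier c₂ ]}
         {B̄ : Obj A} {π̄₁ : A [ B̄ , ContraFunctor.F₀ P (Coalgebra.carrier c₁) ]}
         {π̄₂ : A [ B̄ , ContraFunctor.F₀ P (Coalgebra.carrier c₂) ]}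
         (dual : IsDualSpan lg π₁ π₂ π̄₁ π̄₂) where
  open IsPullback dual

  bisimulation⇒congruence : IsRhoBisimulation lg c₁ c₂ π₁ π₂ π̄₁ π̄₂ →
                            IsCongruence lg c₁ c₂ π̄₁ π̄₂
  bisimulation⇒congruence bisim =
    pullback-jointlyMono A dual ,
    universal _ _ bisim , p₁∘universal bisim , p₂∘universal bisim

  congruence⇒bisimulation : IsCongruence lg c₁ c₂ π̄₁ π̄₂ →
                            IsRhoBisimulation lg c₁ c₂ π₁ π₂ π̄₁ π̄₂
  congruence⇒bisimulation (_ , β , π̄₁β≈γ₁* , π̄₂β≈γ₂*) =
    commute-via-factorisation A β commute π̄₁β≈γ₁* π̄₂β≈γ₂*

-- The adjunction, the existence of limits and joint monicity of (π₁, π₂) only serve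
-- in the paper to construct the dual span; here it is given.
proposition3p2 : ∀ {o ℓ e o' ℓ' e'} (C : Category o ℓ e) (A : Category o' ℓ' e')
    (P : ContraFunctor C A) (S : ContraFunctor A C) →
    DualAdjunction C A P S →
    HasPullbacks C →
    (HasPullbacks A ⊎ HasPushouts C) →
    (T : Functor C C) (lg : Logic P T) (c₁ c₂ : Coalgebra T)
    {B : Obj C} (π₁ : C [ B , Coalgebra.carrier c₁ ]) (π₂ : C [ B , Coalgebra.carrier c₂ ]) →
    JointlyMono C π₁ π₂ →
    {B̄ : Obj A} (π̄₁ : A [ B̄ , ContraFunctor.F₀ P (Coalgebra.carrier c₁) ])
    (π̄₂ : A [ B̄ , ContraFunctor.F₀ P (Coalgebra.carrier c₂) ]) →
    IsDualSpan lg π₁ π₂ π̄₁ π̄₂ →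
    (IsRhoBisimulation lg c₁ c₂ π₁ π₂ π̄₁ π̄₂ → IsCongruence lg c₁ c₂ π̄₁ π̄₂) ×
    (IsCongruence lg c₁ c₂ π̄₁ π̄₂ → IsRhoBisimulation lg c₁ c₂ π₁ π₂ π̄₁ π̄₂)
proposition3p2 _ _ _ _ _ _ _ _ lg c₁ c₂ _ _ _ _ _ dual =
  bisimulation⇒congruence lg c₁ c₂ dual , congruence⇒bisimulation lg c₁ c₂ dual
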